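{- Let $G=(V,E)$ be a connected proper chordal graph and $(T,r,\rho)$ an indifference tree-layout of $G$. For every vertex $x\in V$, the node set $\rho(B(x))$ is the node set of a downward path of $T$ starting at $\rho(x)$ (each node of the path being a child of the previous one), and $B(x)$ induces a clique in $G$.
   Context: A tree-layout of $G=(V,E)$ is a triple $(T,r,\rho)$ with $T$ a tree on $|V|$ nodes rooted at $r$ and $\rho:V\to V(T)$ a bijection such that for every edge $xy$, $\rho(x)$ is an ancestor of $\rho(y)$ or vice versa. Write $u\prec v$ if $\rho(u)$ is a proper ancestor of $\rho(v)$; $A(v)=\{u:u\prec v\}$, $D(v)=\{u:v\prec u\}$, $D[v]=D(v)\cup\{v\}$. $G$ is proper chordal if it admits a tree-layout with no $x\prec y\prec z$ such that $xz\in E$ and exactly one of $xy,yz$ is in $E$. An indifference tree-layout is a tree-layout with no $x\prec y\prec z$ such that $xz\in E$ and ($xy\notin E$ or $yz\notin E$). For $S\subseteq V$, $N(S)$ is the set of vertices outside $S$ with a neighbour in $S$. For nonempty $S$ and a connected component $C$ of $G-S$, a vertex $v\in C$ is $S$-maximal if $N(w)\cap S\subseteq N(v)\cap S$ for every $w\in C$; $v$ is $U$-universal if $v$ is adjacent to every vertex of $U\setminus\{v\}$. The $S$-block of $C$ is the set of vertices of $C$ that are $S$-maximal and $(N(S)\cap C)$-universal. For $x\ne\rho^{ -1}(r)$, $B(x)$ is the $A(x)$-block of the component of $G-A(x)$ containing $x$ (it contains $x$); for the root vertex $x=\rho^{ -1}(r)$, $B(x)=\{x\}$. -}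

module Defs where

open import Data.Nat using (ℕ; zero; suc)
open import Data.Fin using (Fin)
open import Data.Bool using (Bool; true; false)
open import Data.Maybe using (Maybe; just; nothing; _>>=_)
open import Data.List using (List; []; _∷_)
open import Data.List.Membership.Propositional using (_∈_)
open import Data.Product using (Σ; ∃; _×_; _,_)
open import Data.Sum using (_⊎_)
open import Data.Unit using (⊤)
open import Relation.Nullary using (¬_)
open import Relation.Binary.PropositionalEquality using (_≡_; _≢_)
open import Function.Definitions using (Bijective)

record Graph (n : ℕ) : Set where
  field
    adj    : Fin n → Fin n → Bool
    sym    : ∀ x y → adj x y ≡ adj y x
    irrefl : ∀ x → adj x x ≡ false

module _ {n : ℕ} (G : Graph n) where
  open Graph G

  Edge : Fin n → Fin n → Set
  Edge x y = adj x y ≡ true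

  data ReachIn (P : Fin n → Set) (u : Fin n) : Fin n → Set where
    here : P u → ReachIn P u u
    step : ∀ {w v} → ReachIn P u w → Edge w v → P v → ReachIn P u v

  Connected : Set
  Connected = ∀ u v → ReachIn (λ _ → ⊤) u v

  InN : (Fin n → Set) → Fin n → Set
  InN S u = ¬ S u × ∃ λ s → S s × Edge u s

  SMaximal : (S C : Fin n → Set) → Fin n → Set
  SMaximal S C v = ∀ w → C w → ∀ s → S s → Edge w s → Edge v s

  Universal : (U : Fin n → Set) → Fin n → Set
  Universal U v = ∀ u → U u → u ≢ v → Edge v u

  InBlock : (S C : Fin n → Set) → Fin n → Set
  InBlock S C v = C v × SMaximal S C v × Universal (λ u → InN S u × C u) v

  InComp : (S : Fin n → Set) → Fin n → Fin n → Set
  InComp S x v = ReachIn (λ w → ¬ S w) x v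

iterParent : {n : ℕ} → (Fin n → Maybe (Fin n)) → ℕ → Fin n → Maybe (Fin n)
iterParent p zero    t = just t
iterParent p (suc k) t = iterParent p k t >>= p

record RootedTree (n : ℕ) : Set where
  field
    parent     : Fin n → Maybe (Fin n)
    root       : Fin n
    root-top   : parent root ≡ nothing
    nonroot    : ∀ t → t ≢ root → ∃ λ p → parent t ≡ just p
    -- every node reaches the root (hence no cycles)
    reach-root : ∀ t → ∃ λ k → iterParent parent k t ≡ just root

  Anc : Fin n → Fin n → Set
  Anc a b = ∃ λ k → iterParent parent k b ≡ just a

  PAnc : Fin n → Fin n → Set
  PAnc a b = ∃ λ k → iterParent parent (suc k) b ≡ just a

  Child : Fin n → Fin n → Set
  Child c p = parent c ≡ just p

  DownFrom : Fin n → List (Fin n) → Set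
  DownFrom t []       = ⊤
  DownFrom t (c ∷ cs) = Child c t × DownFrom c cs

record TreeLayout {n : ℕ} (G : Graph n) : Set where
  field
    T     : RootedTree n
    ρ     : Fin n → Fin n
    ρ-bij : Bijective _≡_ _≡_ ρ
  open RootedTree T public
  field
    edge-anc : ∀ x y → Edge G x y → Anc (ρ x) (ρ y) ⊎ Anc (ρ y) (ρ x)

  _≺_ : Fin n → Fin n → Set
  u ≺ v = PAnc (ρ u) (ρ v)

  InA : Fin n → Fin n → Set
  InA v u = u ≺ v

  InB : Fin n → Fin n → Set
  InB x v = (ρ x ≡ root × v ≡ x)
          ⊎ (ρ x ≢ root × InBlock G (InA x) (InComp G (InA x) x) v)

module _ {n : ℕ} {G : Graph n} where

  IsProperLayout : TreeLayout G → Set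
  IsProperLayout L = ∀ x y z → x ≺ y → y ≺ z → Edge G x z →
      ¬ ((Edge G x y × ¬ Edge G y z) ⊎ (¬ Edge G x y × Edge G y z))
    where open TreeLayout L

  IsIndifferenceLayout : TreeLayout G → Set
  IsIndifferenceLayout L = ∀ x y z → x ≺ y → y ≺ z → Edge G x z →
      ¬ (¬ Edge G x y ⊎ ¬ Edge G y z)
    where open TreeLayout L

ProperChordal : {n : ℕ} → Graph n → Set
ProperChordal G = Σ (TreeLayout G) IsProperLayout

{-# OPTIONS --safe #-}
module Submission where

-- For a non-root x let A = A(x) and C the component of G − A containing x. C lies in the
-- subtree of x, since an edge leaving that subtree from C ends in an ancestor of x, i.e. in A.
-- Indifference makes x a block vertex: an edge from s ∈ A to a descendant u of x forces the
-- edges s x and x u. Universality makes the block a clique, so its vertices are pairwise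
-- comparable in T; and for x ≺ y ≺ v with v in the block, the chord x v together with
-- indifference passes maximality and universality from v to y. A chain through x that is
-- convex in this sense is the downward path from x to its deepest vertex.

open import Defs
open import Data.Nat using (ℕ; zero; suc; _+_; _*_; _∸_; _<_; _≤?_; s≤s)
open import Data.Nat.Properties using (≤-total; m∸n+n≡m; +-suc; m≤m*n; ≰⇒>)
open import Data.Fin using (Fin; toℕ; fromℕ<; _≟_)
open import Data.Fin.Properties using (any?; all?; toℕ-fromℕ<)
open import Data.Bool using (true)
open import Data.Bool.Properties using () renaming (_≟_ to _≟ᵇ_)
open import Data.Maybe using (Maybe; just; nothing; _>>=_)
open import Data.Maybe.Properties using (≡-dec; just-injective)
open import Data.List using (List; []; _∷_; allFin)
open import Data.List.Relation.Unary.Any using (here; there)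
open import Data.List.Membership.Propositional using (_∈_)
open import Data.List.Membership.Propositional.Properties using (∈-allFin)
open import Data.Product using (∃; _×_; _,_; proj₁; proj₂)
open import Data.Sum using (_⊎_; inj₁; inj₂)
open import Data.Unit using (⊤; tt)
open import Data.Empty using (⊥; ⊥-elim)
open import Function.Bundles using (_⇔_; mk⇔; Equivalence)
import Function.Properties.Equivalence as ⇔
open import Relation.Nullary using (¬_; Dec; yes; no)
open import Relation.Nullary.Decidable using (map; _×-dec_; _⊎-dec_; _→-dec_; ¬?)
open import Relation.Unary using (Decidable)
open import Relation.Binary.PropositionalEquality using (_≡_; _≢_; refl; sym; trans; cong; subst; ≢-sym)

module RootedTreeProperties {n : ℕ} (T : RootedTree n) where
  open RootedTree T

  up : ℕ → Fin n → Maybe (Fin n)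
  up = iterParent parent

  up-+ : ∀ j {k t s} → up k t ≡ just s → up (j + k) t ≡ up j s
  up-+ zero    eq = eq
  up-+ (suc j) eq = cong (_>>= parent) (up-+ j eq)

  up-suc : ∀ k t → up (suc k) t ≡ (parent t >>= up k)
  up-suc zero t with parent t
  ... | nothing = refl
  ... | just _  = refl
  up-suc (suc k) t rewrite up-suc k t with parent t
  ... | nothing = refl
  ... | just _  = refl

  up-root : ∀ k → up (suc k) root ≡ nothing
  up-root zero    = root-top
  up-root (suc k) rewrite up-root k = refl

  up-beyond-root : ∀ {k t m} → up k t ≡ just root → k < m → up m t ≡ nothing
  up-beyond-root {k} {t} {m} eq k<m =
    subst (λ i → up i t ≡ nothing) (trans (sym (+-suc (m ∸ suc k) k)) (m∸n+n≡m k<m))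
          (trans (up-+ (suc (m ∸ suc k)) eq) (up-root (m ∸ suc k)))

  -- A cycle of length suc k could be pumped past the depth of t, where up yields nothing.
  up-acyclic : ∀ k t → up (suc k) t ≢ just t
  up-acyclic k t cycle with reach-root t
  ... | d , toRoot
    with trans (sym (up-beyond-root toRoot (m≤m*n (suc d) (suc k)))) (pump (suc d))
    where
    pump : ∀ c → up (c * suc k) t ≡ just t
    pump zero    = refl
    pump (suc c) = trans (up-+ (suc k) (pump c)) cycle
  ... | ()

  Comparable : Fin n → Fin n → Set
  Comparable a b = Anc a b ⊎ Anc b a

  Anc-refl : ∀ {a} → Anc a a
  Anc-refl = 0 , refl

  Anc-trans : ∀ {a b c} → Anc a b → Anc b c → Anc a c
  Anc-trans (j , p) (k , q) = j + k , trans (up-+ j q) p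

  PAnc-trans : ∀ {a b c} → PAnc a b → PAnc b c → PAnc a c
  PAnc-trans (j , p) (k , q) = j + suc k , trans (up-+ (suc j) q) p

  PAnc⇒Anc : ∀ {a b} → PAnc a b → Anc a b
  PAnc⇒Anc (k , p) = suc k , p

  Anc∧≢⇒PAnc : ∀ {a b} → Anc a b → a ≢ b → PAnc a b
  Anc∧≢⇒PAnc (zero  , p) a≢b = ⊥-elim (a≢b (sym (just-injective p)))
  Anc∧≢⇒PAnc (suc k , p) _   = k , p

  PAnc-irrefl : ∀ {a} → ¬ PAnc a a
  PAnc-irrefl {a} (k , p) = up-acyclic k a p

  Anc-antisym : ∀ {a b} → Anc a b → Anc b a → a ≡ b
  Anc-antisym         (zero  , p) _           = sym (just-injective p)
  Anc-antisym {a} {b} (k     , p) (suc j , q) = ⊥-elim (up-acyclic (j + k) b (trans (up-+ (suc j) p) q))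
  Anc-antisym {a} {b} (suc k , p) (zero  , q) = ⊥-elim (up-acyclic k b (trans p q))

  ancestors-comparable : ∀ {a b t} → Anc a t → Anc b t → Comparable a b
  ancestors-comparable {a} {b} {t} (i , p) (j , q) with ≤-total i j
  ... | inj₁ i≤j = inj₂ (j ∸ i , trans (sym (up-+ (j ∸ i) p))
                           (subst (λ k → up k t ≡ just b) (sym (m∸n+n≡m i≤j)) q))
  ... | inj₂ j≤i = inj₁ (i ∸ j , trans (sym (up-+ (i ∸ j) q))
                           (subst (λ k → up k t ≡ just a) (sym (m∸n+n≡m j≤i)) p))

  -- Only the first (depth of b) + 1 iterates of parent need to be searched.
  Anc? : ∀ a b → Dec (Anc a b)
  Anc? a b with reach-root b
  ... | d , toRoot with any? {n = suc d} (λ i → ≡-dec _≟_ (up (toℕ i) b) (just a))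
  ... | yes (i , p) = yes (toℕ i , p)
  ... | no none = no λ (k , p) → outOfRange k p
    where
    outOfRange : ∀ k → up k b ≢ just a
    outOfRange k p with k ≤? d
    ... | yes k≤d = none (fromℕ< (s≤s k≤d) , subst (λ i → up i b ≡ just a) (sym (toℕ-fromℕ< (s≤s k≤d))) p)
    ... | no k≰d with trans (sym (up-beyond-root toRoot (≰⇒> k≰d))) p
    ... | ()

  PAnc? : ∀ a b → Dec (PAnc a b)
  PAnc? a b with Anc? a b | a ≟ b
  ... | yes a≤b | yes refl = no PAnc-irrefl
  ... | yes a≤b | no a≢b   = yes (Anc∧≢⇒PAnc a≤b a≢b)
  ... | no a≰b  | _        = no λ a<b → a≰b (PAnc⇒Anc a<b)

  Child⇒Anc : ∀ {c p} → Child c p → Anc p c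
  Child⇒Anc c→p = 1 , c→p

  Anc-between-child : ∀ {c p y} → Child c p → Anc y c → Anc p y → y ≡ c ⊎ y ≡ p
  Anc-between-child _ (zero , q) _ = inj₁ (sym (just-injective q))
  Anc-between-child {c} c→p (suc k , q) p≤y =
    inj₂ (Anc-antisym (k , trans (sym (subst (λ m → up (suc k) c ≡ (m >>= up k)) c→p (up-suc k c))) q) p≤y)

  climb : ∀ {a} k t → up (suc k) t ≡ just a → ∃ λ p → Child t p × up k p ≡ just a
  climb k t eq rewrite up-suc k t with parent t
  ... | just p = p , refl , eq

  module _ {a d : Fin n} where
    IsInterval : Fin n → List (Fin n) → Set
    IsInterval t cs = ∀ y → (y ∈ t ∷ cs) ⇔ (Anc t y × Anc y d)

    extendUpwards : ∀ k t → up k t ≡ just a → (cs : List (Fin n)) → DownFrom t cs → IsInterval t cs →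
                    ∃ λ cs′ → DownFrom a cs′ × IsInterval a cs′
    extendUpwards zero t refl cs down interval = cs , down , interval
    extendUpwards (suc k) t eq cs down interval with climb k t eq
    ... | p , t→p , p↑a = extendUpwards k p p↑a (t ∷ cs) (t→p , down) (λ y → mk⇔ (to y) (from y))
      where
      t≤d : Anc t d
      t≤d = proj₂ (Equivalence.to (interval t) (here refl))
      to : ∀ y → y ∈ p ∷ t ∷ cs → Anc p y × Anc y d
      to y (here refl) = Anc-refl , Anc-trans (Child⇒Anc t→p) t≤d
      to y (there y∈) with Equivalence.to (interval y) y∈
      ... | t≤y , y≤d = Anc-trans (Child⇒Anc t→p) t≤y , y≤d
      from : ∀ y → Anc p y × Anc y d → y ∈ p ∷ t ∷ cs
      from y (p≤y , y≤d) with ancestors-comparable t≤d y≤d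
      ... | inj₁ t≤y = there (Equivalence.from (interval y) (t≤y , y≤d))
      ... | inj₂ y≤t with Anc-between-child t→p y≤t p≤y
      ... | inj₁ y≡t = there (here y≡t)
      ... | inj₂ y≡p = here y≡p

  interval-downPath : ∀ {a d} → Anc a d →
    ∃ λ cs → DownFrom a cs × ∀ y → (y ∈ a ∷ cs) ⇔ (Anc a y × Anc y d)
  interval-downPath (k , d↑a) = extendUpwards k _ d↑a [] tt singleton
    where
    singleton : ∀ {d} y → (y ∈ d ∷ []) ⇔ (Anc d y × Anc y d)
    singleton y = mk⇔ (λ { (here refl) → Anc-refl , Anc-refl }) (λ (d≤y , y≤d) → here (Anc-antisym y≤d d≤y))

  module _ {m : ℕ} (f : Fin m → Fin n) {P : Fin m → Set} (P? : Decidable P)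
           (P-chain : ∀ {u v} → P u → P v → Comparable (f u) (f v)) where

    deepest-in : ∀ {x} → P x → (vs : List (Fin m)) →
                 ∃ λ d → P d × ∀ v → v ∈ vs → P v → Anc (f v) (f d)
    deepest-in Px []       = _ , Px , λ _ ()
    deepest-in Px (v ∷ vs) with deepest-in Px vs | P? v
    ... | d , Pd , below | no ¬Pv = d , Pd , λ { _ (here refl) Pv → ⊥-elim (¬Pv Pv) ; w (there w∈) → below w w∈ }
    ... | d , Pd , below | yes Pv with P-chain Pd Pv
    ...   | inj₁ d≤v = v , Pv , λ { _ (here refl) _ → Anc-refl ; w (there w∈) Pw → Anc-trans (below w w∈ Pw) d≤v }
    ...   | inj₂ v≤d = d , Pd , λ { _ (here refl) _ → v≤d ; w (there w∈) → below w w∈ }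

    convexChain-downPath : ∀ {x} → P x → (∀ {v} → P v → Anc (f x) (f v)) →
      (∀ {v y} → P v → Anc (f x) (f y) → Anc (f y) (f v) → P y) →
      ∃ λ cs → DownFrom (f x) cs × ∀ v → P v ⇔ (f v ∈ f x ∷ cs)
    convexChain-downPath Px below-x convex with deepest-in Px (allFin m)
    ... | d , Pd , below-d with interval-downPath (below-x Pd)
    ... | cs , down , interval =
      cs , down , λ v → mk⇔ (λ Pv → Equivalence.from (interval (f v)) (below-x Pv , below-d v (∈-allFin v) Pv))
                             (λ v∈ → let x≤v , v≤d = Equivalence.to (interval (f v)) v∈ in convex Pd x≤v v≤d)

module IndifferenceLayoutBlocks {n : ℕ} {G : Graph n} (L : TreeLayout G) (indifference : IsIndifferenceLayout L) where
  open TreeLayout L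
  open RootedTreeProperties T

  ρ-injective : ∀ {u v} → ρ u ≡ ρ v → u ≡ v
  ρ-injective = proj₁ ρ-bij

  Anc∧≢⇒≺ : ∀ {u v} → Anc (ρ u) (ρ v) → u ≢ v → u ≺ v
  Anc∧≢⇒≺ u≤v u≢v = Anc∧≢⇒PAnc u≤v (λ eq → u≢v (ρ-injective eq))

  Edge? : ∀ u v → Dec (Edge G u v)
  Edge? u v = Graph.adj G u v ≟ᵇ true

  Edge-sym : ∀ {u v} → Edge G u v → Edge G v u
  Edge-sym {u} {v} e = trans (Graph.sym G v u) e

  chord⇒edges : ∀ {a b c} → a ≺ b → b ≺ c → Edge G a c → Edge G a b × Edge G b c
  chord⇒edges {a} {b} {c} a≺b b≺c ac with Edge? a b | Edge? b c
  ... | yes ab | yes bc = ab , bc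
  ... | no ¬ab | _      = ⊥-elim (indifference a b c a≺b b≺c ac (inj₁ ¬ab))
  ... | yes _  | no ¬bc = ⊥-elim (indifference a b c a≺b b≺c ac (inj₂ ¬bc))

  chord⇒edgeˡ : ∀ {a b c} → a ≺ b → b ≺ c → Edge G a c → Edge G a b
  chord⇒edgeˡ a≺b b≺c ac = proj₁ (chord⇒edges a≺b b≺c ac)

  chord⇒edgeʳ : ∀ {a b c} → a ≺ b → b ≺ c → Edge G a c → Edge G b c
  chord⇒edgeʳ a≺b b≺c ac = proj₂ (chord⇒edges a≺b b≺c ac)

  ≺⇒≢ : ∀ {u v} → u ≺ v → u ≢ v
  ≺⇒≢ u≺v refl = PAnc-irrefl u≺v

  ≺? : ∀ u v → Dec (u ≺ v)
  ≺? u v = PAnc? (ρ u) (ρ v)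

  InB-root : ∀ {x v} → ρ x ≡ root → InB x v ⇔ v ≡ x
  InB-root isRoot = mk⇔ (λ { (inj₁ (_ , v≡x)) → v≡x ; (inj₂ (nonRoot , _)) → ⊥-elim (nonRoot isRoot) })
                        (λ v≡x → inj₁ (isRoot , v≡x))

  BlockIsDownPath : Fin n → Set
  BlockIsDownPath x = ∃ λ cs → DownFrom (ρ x) cs × ∀ v → InB x v ⇔ (ρ v ∈ ρ x ∷ cs)

  BlockIsClique : Fin n → Set
  BlockIsClique x = ∀ u v → InB x u → InB x v → u ≢ v → Edge G u v

  root-block-downPath : ∀ {x} → ρ x ≡ root → BlockIsDownPath x
  root-block-downPath {x} isRoot = [] , tt , λ v → ⇔.trans (InB-root isRoot) (mk⇔ to from)
    where
    to : ∀ {v} → v ≡ x → ρ v ∈ ρ x ∷ []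
    to refl = here refl
    from : ∀ {v} → ρ v ∈ ρ x ∷ [] → v ≡ x
    from (here ρv≡ρx) = ρ-injective ρv≡ρx

  root-block-clique : ∀ {x} → ρ x ≡ root → BlockIsClique x
  root-block-clique isRoot u v Bu Bv u≢v =
    ⊥-elim (u≢v (trans (Equivalence.to (InB-root isRoot) Bu) (sym (Equivalence.to (InB-root isRoot) Bv))))

  InB-nonroot : ∀ {x v} → ρ x ≢ root → InB x v ⇔ InBlock G (InA x) (InComp G (InA x) x) v
  InB-nonroot nonRoot = mk⇔ (λ { (inj₁ (isRoot , _)) → ⊥-elim (nonRoot isRoot) ; (inj₂ (_ , Bv)) → Bv })
                            (λ Bv → inj₂ (nonRoot , Bv))

  module Block (connected : Connected G) (x : Fin n) (nonRoot : ρ x ≢ root) where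
    A : Fin n → Set
    A = InA x

    C : Fin n → Set
    C = InComp G A x

    B : Fin n → Set
    B = InBlock G A C

    A-nonempty : ∃ λ s → A s
    A-nonempty with nonroot (ρ x) nonRoot
    ... | p , x→p with proj₂ ρ-bij p
    ... | s , ρs≡p = s , 0 , trans x→p (cong just (sym (ρs≡p refl)))

    x∉A : ¬ A x
    x∉A = PAnc-irrefl

    x∈C : C x
    x∈C = here x∉A

    C-avoids-A : ∀ {v} → C v → ¬ A v
    C-avoids-A (here ¬Av)     = ¬Av
    C-avoids-A (step _ _ ¬Av) = ¬Av

    C-below-x : ∀ {v} → C v → Anc (ρ x) (ρ v)
    C-below-x (here _) = Anc-refl
    C-below-x {v} (step {w} w∈C wv ¬Av) with edge-anc w v wv
    ... | inj₁ w≤v = Anc-trans (C-below-x w∈C) w≤v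
    ... | inj₂ v≤w with ancestors-comparable (C-below-x w∈C) v≤w
    ...   | inj₁ x≤v = x≤v
    ...   | inj₂ v≤x with v ≟ x
    ...     | yes refl = Anc-refl
    ...     | no v≢x   = ⊥-elim (¬Av (Anc∧≢⇒≺ v≤x v≢x))

    C-cases : ∀ {v} → C v → v ≡ x ⊎ x ≺ v
    C-cases {v} v∈C with x ≟ v
    ... | yes x≡v = inj₁ (sym x≡v)
    ... | no x≢v  = inj₂ (Anc∧≢⇒≺ (C-below-x v∈C) x≢v)

    A-neighbour-of-C⇒of-x : ∀ {w s} → C w → A s → Edge G w s → Edge G x s
    A-neighbour-of-C⇒of-x w∈C s≺x ws with C-cases w∈C
    ... | inj₁ refl = ws
    ... | inj₂ x≺w  = Edge-sym (chord⇒edgeˡ s≺x x≺w (Edge-sym ws))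

    A-neighbour-below-x⇒C : ∀ {u s} → x ≺ u → A s → Edge G u s → C u
    A-neighbour-below-x⇒C x≺u s≺x us =
      step x∈C (chord⇒edgeʳ s≺x x≺u (Edge-sym us)) (λ u≺x → PAnc-irrefl (PAnc-trans u≺x x≺u))

    leave-C : ∀ {t} → ReachIn G (λ _ → ⊤) x t → C t ⊎ ∃ λ w → ∃ λ s → C w × A s × Edge G w s
    leave-C (here _) = inj₁ x∈C
    leave-C (step {w} {v} path wv _) with leave-C path
    ... | inj₂ exit = inj₂ exit
    ... | inj₁ w∈C with ≺? v x
    ...   | yes v≺x = inj₂ (w , v , w∈C , v≺x , wv)
    ...   | no ¬v≺x = inj₁ (step w∈C wv ¬v≺x)

    x-A-neighbour : ∃ λ s → A s × Edge G x s
    x-A-neighbour with leave-C (connected x (proj₁ A-nonempty))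
    ... | inj₁ s∈C                    = ⊥-elim (C-avoids-A s∈C (proj₂ A-nonempty))
    ... | inj₂ (w , s , w∈C , As , ws) = s , As , A-neighbour-of-C⇒of-x w∈C As ws

    x∈N[A] : InN G A x
    x∈N[A] = x∉A , x-A-neighbour

    B⊆N[A]∩C : ∀ {v} → B v → InN G A v × C v
    B⊆N[A]∩C (v∈C , maximal , _) with x-A-neighbour
    ... | s , As , xs = (C-avoids-A v∈C , s , As , maximal x x∈C s As xs) , v∈C

    x∈B : B x
    x∈B = x∈C , (λ w w∈C s As ws → A-neighbour-of-C⇒of-x w∈C As ws) , universal
      where
      universal : Universal G (λ u → InN G A u × C u) x
      universal u ((_ , s , s≺x , us) , u∈C) u≢x with C-cases u∈C
      ... | inj₁ u≡x = ⊥-elim (u≢x u≡x)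
      ... | inj₂ x≺u = chord⇒edgeʳ s≺x x≺u (Edge-sym us)

    B-clique : ∀ {u v} → B u → B v → u ≢ v → Edge G u v
    B-clique (_ , _ , universal) Bv u≢v = universal _ (B⊆N[A]∩C Bv) (≢-sym u≢v)

    B-comparable : ∀ {u v} → B u → B v → Comparable (ρ u) (ρ v)
    B-comparable {u} {v} Bu Bv with u ≟ v
    ... | yes refl = inj₁ Anc-refl
    ... | no u≢v   = edge-anc u v (B-clique Bu Bv u≢v)

    B-convex : ∀ {v y} → B v → Anc (ρ x) (ρ y) → Anc (ρ y) (ρ v) → B y
    B-convex {v} {y} Bv@(v∈C , v-maximal , v-universal) x≤y y≤v with x ≟ y | y ≟ v
    ... | yes refl | _        = x∈B
    ... | no _     | yes refl = Bv
    ... | no x≢y   | no y≢v   = y∈C , y-maximal , y-universal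
      where
      x≺y : x ≺ y
      x≺y = Anc∧≢⇒≺ x≤y x≢y
      y≺v : y ≺ v
      y≺v = Anc∧≢⇒≺ y≤v y≢v
      xv : Edge G x v
      xv = Edge-sym (v-universal x (x∈N[A] , x∈C) (≺⇒≢ (PAnc-trans x≺y y≺v)))
      y∈C : C y
      y∈C = step x∈C (chord⇒edgeˡ x≺y y≺v xv) (λ y≺x → PAnc-irrefl (PAnc-trans y≺x x≺y))
      y-maximal : SMaximal G A C y
      y-maximal w w∈C s s≺x ws =
        Edge-sym (chord⇒edgeˡ (PAnc-trans s≺x x≺y) y≺v (Edge-sym (v-maximal w w∈C s s≺x ws)))
      A-neighbour-below-y : ∀ {u s} → A s → Edge G u s → y ≺ u → Edge G y u
      A-neighbour-below-y s≺x us y≺u = chord⇒edgeʳ (PAnc-trans s≺x x≺y) y≺u (Edge-sym us)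
      y-universal : Universal G (λ u → InN G A u × C u) y
      y-universal u u∈N[A]∩C@((_ , s , s≺x , us) , _) u≢y with u ≟ v
      ... | yes refl = chord⇒edgeʳ x≺y y≺v xv
      ... | no u≢v with edge-anc v u (v-universal u u∈N[A]∩C u≢v)
      ...   | inj₁ v≤u = A-neighbour-below-y s≺x us (PAnc-trans y≺v (Anc∧≢⇒≺ v≤u (≢-sym u≢v)))
      ...   | inj₂ u≤v with ancestors-comparable u≤v (PAnc⇒Anc y≺v)
      ...     | inj₁ u≤y = Edge-sym (chord⇒edgeˡ (Anc∧≢⇒≺ u≤y u≢y) y≺v (Edge-sym (v-universal u u∈N[A]∩C u≢v)))
      ...     | inj₂ y≤u = A-neighbour-below-y s≺x us (Anc∧≢⇒≺ y≤u (≢-sym u≢y))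

    Below-x : Fin n → Set
    Below-x u = u ≡ x ⊎ x ≺ u

    -- B described without reference to the component C, which makes it decidable.
    LocalB : Fin n → Set
    LocalB v = (v ≡ x ⊎ (x ≺ v × Edge G x v))
             × (∀ s → A s → Edge G x s → Edge G v s)
             × (∀ u → Below-x u → (∃ λ s → A s × Edge G u s) → u ≢ v → Edge G v u)

    LocalB? : Decidable LocalB
    LocalB? v = ((v ≟ x) ⊎-dec (≺? x v ×-dec Edge? x v))
      ×-dec all? (λ s → ≺? s x →-dec (Edge? x s →-dec Edge? v s))
      ×-dec all? (λ u → ((u ≟ x) ⊎-dec ≺? x u) →-dec
                   (any? (λ s → ≺? s x ×-dec Edge? u s) →-dec (¬? (u ≟ v) →-dec Edge? v u)))

    Below-x∧A-neighbour⇒C : ∀ {u s} → Below-x u → A s → Edge G u s → C u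
    Below-x∧A-neighbour⇒C (inj₁ refl) _   _  = x∈C
    Below-x∧A-neighbour⇒C (inj₂ x≺u)  s≺x us = A-neighbour-below-x⇒C x≺u s≺x us

    B⇔LocalB : ∀ v → B v ⇔ LocalB v
    B⇔LocalB v = mk⇔ to from
      where
      to : B v → LocalB v
      to (v∈C , maximal , universal) = below-x , maximal x x∈C , local-universal
        where
        below-x : v ≡ x ⊎ (x ≺ v × Edge G x v)
        below-x with C-cases v∈C
        ... | inj₁ v≡x = inj₁ v≡x
        ... | inj₂ x≺v = inj₂ (x≺v , Edge-sym (universal x (x∈N[A] , x∈C) (≺⇒≢ x≺v)))
        local-universal : ∀ u → Below-x u → (∃ λ s → A s × Edge G u s) → u ≢ v → Edge G v u
        local-universal u u-below (s , s≺x , us) = universal u ((C-avoids-A u∈C , s , s≺x , us) , u∈C)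
          where
          u∈C : C u
          u∈C = Below-x∧A-neighbour⇒C u-below s≺x us
      from : LocalB v → B v
      from (below-x , maximal , universal) =
        v∈C below-x ,
        (λ w w∈C s s≺x ws → maximal s s≺x (A-neighbour-of-C⇒of-x w∈C s≺x ws)) ,
        (λ u ((_ , s , s≺x , us) , u∈C) → universal u (C-cases u∈C) (s , s≺x , us))
        where
        v∈C : v ≡ x ⊎ (x ≺ v × Edge G x v) → C v
        v∈C (inj₁ refl)      = x∈C
        v∈C (inj₂ (x≺v , xv)) = step x∈C xv (λ v≺x → PAnc-irrefl (PAnc-trans v≺x x≺v))

    B? : Decidable B
    B? v = map (⇔.sym (B⇔LocalB v)) (LocalB? v)

    B-downPath : ∃ λ cs → DownFrom (ρ x) cs × ∀ v → B v ⇔ (ρ v ∈ ρ x ∷ cs)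
    B-downPath = convexChain-downPath ρ B? B-comparable x∈B (λ Bv → C-below-x (proj₁ Bv)) B-convex

    block-downPath : BlockIsDownPath x
    block-downPath with B-downPath
    ... | cs , down , B⇔path = cs , down , λ v → ⇔.trans (InB-nonroot nonRoot) (B⇔path v)

    block-clique : BlockIsClique x
    block-clique u v Bu Bv = B-clique (Equivalence.to (InB-nonroot nonRoot) Bu) (Equivalence.to (InB-nonroot nonRoot) Bv)

mainTheorem10 : {n : ℕ} (G : Graph n) → Connected G → ProperChordal G →
    (L : TreeLayout G) → IsIndifferenceLayout L →
    ∀ x →
      (∃ λ (cs : List (Fin n)) →
         TreeLayout.DownFrom L (TreeLayout.ρ L x) cs ×
         (∀ v → TreeLayout.InB L x v ⇔ (TreeLayout.ρ L v ∈ (TreeLayout.ρ L x ∷ cs))))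
      × (∀ u v → TreeLayout.InB L x u → TreeLayout.InB L x v → u ≢ v → Edge G u v)
mainTheorem10 G connected _ L indifference x with TreeLayout.ρ L x ≟ TreeLayout.root L
... | yes isRoot = root-block-downPath isRoot , root-block-clique isRoot
  where open IndifferenceLayoutBlocks L indifference
... | no nonRoot = block-downPath , block-clique
  where open IndifferenceLayoutBlocks L indifference
        open Block connected x nonRoot
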